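{- Let $k \geq 3$, let $T$ be a perfect $k$-ary tree of height at least $1$, and let $f$ be an independent broadcast on $T$ of maximum weight. Then $f(v) \leq 1$ for all $v \in V(T)$, and $f(l) = 1$ for every leaf $l$ of $T$.
   Context: For a graph $G$, $d(u,v)$ is the distance, $\mathrm{ecc}(v)$ the eccentricity, $\mathrm{diam}(G)$ the diameter. A broadcast on $G$ is a function $f: V(G)\to\{0,\dots,\mathrm{diam}(G)\}$ with $f(v)\le\mathrm{ecc}(v)$; its weight is $\sum_v f(v)$. A vertex $v$ is broadcasting if $f(v)>0$; $u$ hears a broadcasting $v$ if $d(u,v)\le f(v)$. A broadcast is independent if every broadcasting vertex hears only itself. A perfect $k$-ary tree of height $h$ is the rooted tree in which every non-leaf vertex has exactly $k$ children and all leaves are at distance $h$ from the root. -}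

module Defs where

open import Data.Nat using (ℕ; zero; suc; _+_; _≤_; _<_; _≥_; z≤n; s≤s)
open import Data.Nat.Properties using (≤-refl; ≤-trans; n≤1+n)
open import Data.Fin using (Fin)
open import Data.Vec using (Vec; []; _∷_)
open import Data.List using (List; []; _∷_; map; concatMap; allFin; _++_)
open import Data.Nat.ListAction using (sum)
import Data.List
import Data.Empty
open import Data.Product using (Σ; ∃; _×_; _,_)
open import Relation.Binary.PropositionalEquality using (_≡_)

-- A vertex at depth n (0 ≤ n ≤ h) is given by its address: the sequence of
-- child indices (in Fin k) on the path from the root (most recent step first).
record Vertex (k h : ℕ) : Set where
  constructor vtx
  field
    depth : ℕ
    .bound : depth ≤ h
    addr  : Vec (Fin k) depth
open Vertex public

data Adj {k h : ℕ} : Vertex k h → Vertex k h → Set where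
  down : ∀ {n} .{p : n ≤ h} .{q : suc n ≤ h} (i : Fin k) (w : Vec (Fin k) n) →
         Adj (vtx n p w) (vtx (suc n) q (i ∷ w))
  up   : ∀ {n} .{p : n ≤ h} .{q : suc n ≤ h} (i : Fin k) (w : Vec (Fin k) n) →
         Adj (vtx (suc n) q (i ∷ w)) (vtx n p w)

data Walk {k h : ℕ} : Vertex k h → Vertex k h → ℕ → Set where
  nil  : ∀ {u} → Walk u u 0
  cons : ∀ {u w v n} → Adj u w → Walk w v n → Walk u v (suc n)

DistLe : {k h : ℕ} → Vertex k h → Vertex k h → ℕ → Set
DistLe u v r = ∃ λ n → n ≤ r × Walk u v n

DistGe : {k h : ℕ} → Vertex k h → Vertex k h → ℕ → Set
DistGe u v r = ∀ n → n < r → Walk u v n → Data.Empty.⊥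


vecs : (k n : ℕ) → List (Vec (Fin k) n)
vecs k zero    = [] ∷ []
vecs k (suc n) = concatMap (λ i → map (i ∷_) (vecs k n)) (allFin k)

levels : (k h n : ℕ) → n ≤ h → List (Vertex k h)
levels k h zero    p = map (vtx zero p) (vecs k zero)
levels k h (suc n) p =
  levels k h n (≤-trans (n≤1+n n) p) Data.List.++ map (vtx (suc n) p) (vecs k (suc n))

allVertices : (k h : ℕ) → List (Vertex k h)
allVertices k h = levels k h h ≤-refl

-- Broadcasts: f(v) ≤ ecc(v), i.e. some vertex u has d(u,v) ≥ f(v).
-- (Since ecc(v) ≤ diam, this also gives f(v) ≤ diam.)
IsBroadcast : {k h : ℕ} → (Vertex k h → ℕ) → Set
IsBroadcast {k} {h} f = ∀ (v : Vertex k h) → ∃ λ u → DistGe u v (f v)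

Hears : {k h : ℕ} → (Vertex k h → ℕ) → Vertex k h → Vertex k h → Set
Hears f u v = DistLe u v (f v)

IsIndependent : {k h : ℕ} → (Vertex k h → ℕ) → Set
IsIndependent {k} {h} f = ∀ (u v : Vertex k h) → 0 < f u → 0 < f v → Hears f u v → u ≡ v

weight : {k h : ℕ} → (Vertex k h → ℕ) → ℕ
weight {k} {h} f = sum (map f (allVertices k h))

IsIndepBroadcast : {k h : ℕ} → (Vertex k h → ℕ) → Set
IsIndepBroadcast f = IsBroadcast f × IsIndependent f

IsMaxIndepBroadcast : {k h : ℕ} → (Vertex k h → ℕ) → Set
IsMaxIndepBroadcast {k} {h} f =
  IsIndepBroadcast f × (∀ (g : Vertex k h → ℕ) → IsIndepBroadcast g → weight g ≤ weight f)

IsLeaf : {k h : ℕ} → Vertex k h → Set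
IsLeaf {k} {h} v = depth v ≡ h

module Submission where

-- A maximum broadcast cannot be improved, so it suffices to improve any independent broadcast f that
-- has a value ≥ 2 or a silent leaf. Let v₀ be a deepest vertex with r = f v₀ ≥ 2, at height m above
-- the leaves. If r ≤ m, nothing broadcasts near v₀ inside its subtree, and the k ^ (r - 1) descendants
-- at distance r - 1 can take over from v₀ at power 1 each; k ^ (r - 1) > r as k ≥ 3. If r > m, take
-- the ancestor a of v₀ at the largest distance t with m + 2t ≤ r: v₀ hears the whole subtree of a, whose
-- k ^ (m + t) leaves can take over, and k ^ (m + t) > r except when m = 0, t = 1, r = 3. In that case the
-- exchange breaks even but decreases the number of values ≥ 2, so induction on that number applies, and
-- when no such value is left the grandparent of v₀ can be switched on. Finally, once f ≤ 1, a silent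
-- leaf can be switched on if its parent is silent, and otherwise the parent can be replaced by its k
-- leaf children.

open import Defs
open import Data.Nat using (ℕ; zero; suc; _+_; _*_; _^_; _∸_; _≤_; _<_; _≥_; z≤n; s≤s; _≤?_)
import Data.Nat as ℕ
open import Data.Nat.Properties
open import Data.Nat.ListAction using (sum)
open import Data.Nat.ListAction.Properties using (sum-++)
open import Data.Nat.Tactic.RingSolver using (solve-∀)
open import Data.Fin using (Fin) renaming (zero to fzero; suc to fsuc)
import Data.Fin.Properties as Fin
open import Data.Vec using (Vec; []; _∷_)
import Data.Vec.Properties as Vec
open import Data.List using (List; []; _∷_; map; concatMap; allFin; _++_; tabulate)
import Data.List.Properties as List
open import Data.Product using (Σ-syntax; ∃; _×_; _,_; proj₁; proj₂)
open import Data.Sum using (_⊎_; inj₁; inj₂)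
open import Data.Empty using (⊥; ⊥-elim)
open import Function using (_∘_; id)
open import Relation.Nullary using (¬_; Dec; yes; no; recompute)
open import Relation.Nullary.Decidable using (_×-dec_)
open import Relation.Binary.Definitions using (DecidableEquality)
open import Relation.Binary.PropositionalEquality
open import Algebra.Properties.CommutativeSemigroup +-commutativeSemigroup using (interchange)

-- Walks and subtrees

module _ {k : ℕ} where

  -- Addresses list the last step first, so descendants of a vertex have prepended extensions of its address.
  data Extends {n : ℕ} (w : Vec (Fin k) n) : ∀ {m} → Vec (Fin k) m → ℕ → Set where
    here  : Extends w w 0
    there : ∀ {m} {u : Vec (Fin k) m} {e} (i : Fin k) → Extends w u e → Extends w (i ∷ u) (suc e)

  Extends-length : ∀ {n m e} {w : Vec (Fin k) n} {u : Vec (Fin k) m} → Extends w u e → m ≡ e + n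
  Extends-length here = refl
  Extends-length (there i E) = cong suc (Extends-length E)

  Extends-trans : ∀ {n m l e₁ e₂} {w : Vec (Fin k) n} {u : Vec (Fin k) m} {x : Vec (Fin k) l} →
                  Extends w u e₁ → Extends u x e₂ → Extends w x (e₂ + e₁)
  Extends-trans E here = E
  Extends-trans E (there i F) = there i (Extends-trans E F)

  Extends-[] : ∀ {m} (u : Vec (Fin k) m) → Extends [] u m
  Extends-[] [] = here
  Extends-[] (i ∷ u) = there i (Extends-[] u)

  Extends-sameLength⇒≡ : ∀ {n} {w u : Vec (Fin k) n} {e} → Extends w u e → w ≡ u
  Extends-sameLength⇒≡ here = refl
  Extends-sameLength⇒≡ (there {e = e} i E) = ⊥-elim (m+1+n≢n e (sym (Extends-length E)))

  Extends? : ∀ {n m} (w : Vec (Fin k) n) (u : Vec (Fin k) m) → Dec (∃ λ e → Extends w u e)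
  Extends? {n} {m} w u with m ℕ.≟ n
  Extends? w u | yes refl with Vec.≡-dec Fin._≟_ w u
  ... | yes refl = yes (0 , here)
  ... | no w≢u = no (λ (_ , E) → w≢u (Extends-sameLength⇒≡ E))
  Extends? w [] | no m≢n = no (λ (e , E) → m≢n (sym (m+n≡0⇒n≡0 e (sym (Extends-length E)))))
  Extends? w (i ∷ u) | no m≢n with Extends? w u
  ... | yes (e , E) = yes (suc e , there i E)
  ... | no ¬E = no λ { (_ , here) → m≢n refl ; (_ , there _ E) → ¬E (_ , E) }

module _ {k h : ℕ} where

  depth≤height : (v : Vertex k h) → depth v ≤ h
  depth≤height (vtx n p w) = recompute (n ≤? h) p

  vtx-injective : ∀ {n} .{p q : n ≤ h} {w w′ : Vec (Fin k) n} → vtx n p w ≡ vtx n q w′ → w ≡ w′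
  vtx-injective refl = refl

  _≟ᵥ_ : DecidableEquality (Vertex k h)
  vtx n p w ≟ᵥ vtx m q w′ with n ℕ.≟ m
  ... | no n≢m = no (λ eq → n≢m (cong depth eq))
  ... | yes refl with Vec.≡-dec Fin._≟_ w w′
  ...   | yes refl = yes refl
  ...   | no w≢w′ = no (λ eq → w≢w′ (vtx-injective eq))

  Adj-sym : ∀ {u v : Vertex k h} → Adj u v → Adj v u
  Adj-sym (down i w) = up i w
  Adj-sym (up i w) = down i w

  Adj-depth≤ : ∀ {u v : Vertex k h} → Adj u v → depth u ≤ suc (depth v)
  Adj-depth≤ (down i w) = m≤n+m _ 2
  Adj-depth≤ (up i w) = ≤-refl

  Adj⇒depth≢ : ∀ {u v : Vertex k h} → Adj u v → depth u ≢ depth v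
  Adj⇒depth≢ (down i w) eq = 1+n≢n (sym eq)
  Adj⇒depth≢ (up i w) eq = 1+n≢n eq

  _++ʷ_ : ∀ {u w v : Vertex k h} {m n} → Walk u w m → Walk w v n → Walk u v (m + n)
  nil ++ʷ q = q
  cons a p ++ʷ q = cons a (p ++ʷ q)

  snocʷ : ∀ {u w v : Vertex k h} {n} → Walk u w n → Adj w v → Walk u v (suc n)
  snocʷ nil a = cons a nil
  snocʷ (cons b p) a = cons b (snocʷ p a)

  reverseʷ : ∀ {u v : Vertex k h} {n} → Walk u v n → Walk v u n
  reverseʷ nil = nil
  reverseʷ (cons a p) = snocʷ (reverseʷ p) (Adj-sym a)

  Walk-depth≤ : ∀ {u v : Vertex k h} {n} → Walk u v n → depth u ≤ n + depth v
  Walk-depth≤ nil = ≤-refl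
  Walk-depth≤ (cons a p) = ≤-trans (Adj-depth≤ a) (s≤s (Walk-depth≤ p))

  Walk-depth≥ : ∀ {u v : Vertex k h} {n} → Walk u v n → depth v ≤ n + depth u
  Walk-depth≥ p = Walk-depth≤ (reverseʷ p)

  Walk₀⇒≡ : ∀ {u v : Vertex k h} → Walk u v 0 → u ≡ v
  Walk₀⇒≡ nil = refl

  Walk≤1-sameDepth⇒≡ : ∀ {u v : Vertex k h} {n} → n ≤ 1 → Walk u v n → depth u ≡ depth v → u ≡ v
  Walk≤1-sameDepth⇒≡ _ nil _ = refl
  Walk≤1-sameDepth⇒≡ (s≤s z≤n) (cons a nil) eq = ⊥-elim (Adj⇒depth≢ a eq)

  InSubtree : Vertex k h → Vertex k h → ℕ → Set
  InSubtree a x e = Extends (addr a) (addr x) e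

  InSubtree-depth : ∀ {a x : Vertex k h} {e} → InSubtree a x e → depth x ≡ e + depth a
  InSubtree-depth {vtx _ _ _} {vtx _ _ _} E = Extends-length E

  InSubtree-self⇒0 : ∀ {a : Vertex k h} {e} → InSubtree a a e → e ≡ 0
  InSubtree-self⇒0 {a} {e} E = +-cancelʳ-≡ _ e 0 (sym (InSubtree-depth {a} {a} E))

  descentWalk : ∀ (a x : Vertex k h) {e} → InSubtree a x e → Walk a x e
  descentWalk (vtx n p w) (vtx .n q .w) here = nil
  descentWalk a (vtx (suc m) q (i ∷ u)) (there .i E) =
    snocʷ (descentWalk a (vtx m (≤-trans (n≤1+n m) q) u) E) (down i u)

  ascentWalk : ∀ (a x : Vertex k h) {e} → InSubtree a x e → Walk x a e
  ascentWalk a x E = reverseʷ (descentWalk a x E)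

  root : Vertex k h
  root = vtx 0 z≤n []

  InSubtree-root : (x : Vertex k h) → InSubtree root x (depth x)
  InSubtree-root (vtx n p w) = Extends-[] w

  walkThroughRoot : (u v : Vertex k h) → Walk u v (depth u + depth v)
  walkThroughRoot u v = ascentWalk root u (InSubtree-root u) ++ʷ descentWalk root v (InSubtree-root v)

  ancestor : (v : Vertex k h) (t : ℕ) → t ≤ depth v → ∃ λ a → InSubtree a v t
  ancestor v zero _ = v , here
  ancestor v (suc t) t<d with ancestor v t (≤-trans (n≤1+n t) t<d)
  ... | vtx zero p [] , E =
    ⊥-elim (<-irrefl (sym (trans (InSubtree-depth {vtx zero p []} {v} E) (+-identityʳ t))) t<d)
  ... | vtx (suc n) p (i ∷ w) , E =
    vtx n (≤-trans (n≤1+n n) p) w , subst (Extends w (addr v)) (+-comm t 1) (Extends-trans (there i here) E)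

  leafNeighbour⇒parent : ∀ {y l p : Vertex k h} → IsLeaf l → InSubtree p l 1 → Adj y l → y ≡ p
  leafNeighbour⇒parent {p = vtx _ _ _} _ (there i here) (down .i w) = refl
  leafNeighbour⇒parent {y} refl _ (up i w) = ⊥-elim (1+n≰n (depth≤height y))

  NotInSubtree : Vertex k h → Vertex k h → Set
  NotInSubtree a x = ∀ e → ¬ InSubtree a x e

  InSubtree-step : ∀ {a y y′ : Vertex k h} {e} → Adj y y′ → InSubtree a y e →
                   (∃ λ e′ → InSubtree a y′ e′) ⊎ y ≡ a
  InSubtree-step {vtx _ _ _} (down i w) E = inj₁ (_ , there i E)
  InSubtree-step {vtx _ _ _} (up i w) here = inj₂ refl
  InSubtree-step {vtx _ _ _} (up i w) (there .i E) = inj₁ (_ , E)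

  Adj-InSubtree-offset : ∀ {a y y′ : Vertex k h} {e e′} → Adj y y′ →
                         InSubtree a y e → InSubtree a y′ e′ → e ≤ suc e′
  Adj-InSubtree-offset {a} {y} {y′} {e} {e′} adj E E′ = +-cancelʳ-≤ (depth a) e (suc e′)
    (subst₂ (λ s t → s ≤ suc t) (InSubtree-depth {a} {y} E) (InSubtree-depth {a} {y′} E′) (Adj-depth≤ adj))

  -- Leaving the subtree of a costs at least the e steps needed to climb from y back up to a.
  leaveSubtree : ∀ {a x y : Vertex k h} {e n} → NotInSubtree a x → InSubtree a y e → Walk y x n →
                 ∃ λ n′ → n′ + e ≤ n × Walk a x n′
  leaveSubtree x∉ E nil = ⊥-elim (x∉ _ E)
  leaveSubtree {a} {n = suc n} x∉ E (cons adj p) with InSubtree-step {a} adj E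
  ... | inj₂ refl rewrite InSubtree-self⇒0 {a} E = suc n , ≤-reflexive (+-identityʳ _) , cons adj p
  ... | inj₁ (e′ , E′) with leaveSubtree {a} x∉ E′ p
  ...   | n′ , n′+e′≤n , q = n′ , n′+e≤1+n , q
    where
      n′+e≤1+n : n′ + _ ≤ suc n
      n′+e≤1+n = ≤-trans (+-monoʳ-≤ n′ (Adj-InSubtree-offset {a} adj E E′))
                         (≤-trans (≤-reflexive (+-suc n′ e′)) (s≤s n′+e′≤n))

  leaveSubtreeFrom : ∀ {a x v s : Vertex k h} {eᵥ eₛ n} → NotInSubtree a x →
                     InSubtree a v eᵥ → InSubtree a s eₛ → eᵥ ≤ eₛ →
                     Walk s x n → ∃ λ n′ → n′ ≤ n × Walk v x n′
  leaveSubtreeFrom {a} {x} {v} {eᵥ = eᵥ} {eₛ} {n} x∉ Eᵥ Eₛ eᵥ≤eₛ p with leaveSubtree {a} x∉ Eₛ p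
  ... | n′ , n′+eₛ≤n , q = eᵥ + n′ , eᵥ+n′≤n , ascentWalk a v Eᵥ ++ʷ q
    where
      eᵥ+n′≤n : eᵥ + n′ ≤ n
      eᵥ+n′≤n = ≤-trans (≤-reflexive (+-comm eᵥ n′)) (≤-trans (+-monoʳ-≤ n′ eᵥ≤eₛ) n′+eₛ≤n)

-- Counting

𝟙 : ∀ {p} {P : Set p} → Dec P → ℕ
𝟙 (yes _) = 1
𝟙 (no _) = 0

module _ {p} {P : Set p} where

  𝟙-yes : (d : Dec P) → P → 𝟙 d ≡ 1
  𝟙-yes (yes _) _ = refl
  𝟙-yes (no ¬p) p = ⊥-elim (¬p p)

  𝟙-no : (d : Dec P) → ¬ P → 𝟙 d ≡ 0
  𝟙-no (yes p) ¬p = ⊥-elim (¬p p)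
  𝟙-no (no _) _ = refl

  𝟙≤1 : (d : Dec P) → 𝟙 d ≤ 1
  𝟙≤1 (yes _) = ≤-refl
  𝟙≤1 (no _) = z≤n

  𝟙>0⇒ : (d : Dec P) → 0 < 𝟙 d → P
  𝟙>0⇒ (yes p) _ = p

𝟙-mono : ∀ {p q} {P : Set p} {Q : Set q} (d : Dec P) (d′ : Dec Q) → (P → Q) → 𝟙 d ≤ 𝟙 d′
𝟙-mono (yes p) d′ P⇒Q = ≤-reflexive (sym (𝟙-yes d′ (P⇒Q p)))
𝟙-mono (no _) _ _ = z≤n

𝟙-cong : ∀ {p q} {P : Set p} {Q : Set q} (d : Dec P) (d′ : Dec Q) → (P → Q) → (Q → P) → 𝟙 d ≡ 𝟙 d′
𝟙-cong d d′ P⇒Q Q⇒P = ≤-antisym (𝟙-mono d d′ P⇒Q) (𝟙-mono d′ d Q⇒P)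

module _ {A : Set} where

  sum-map-mono : (F G : A → ℕ) (L : List A) → (∀ x → F x ≤ G x) → sum (map F L) ≤ sum (map G L)
  sum-map-mono F G [] _ = z≤n
  sum-map-mono F G (x ∷ L) F≤G = +-mono-≤ (F≤G x) (sum-map-mono F G L F≤G)

  sum-map-+ : (F G : A → ℕ) (L : List A) →
              sum (map (λ x → F x + G x) L) ≡ sum (map F L) + sum (map G L)
  sum-map-+ F G [] = refl
  sum-map-+ F G (x ∷ L) rewrite sum-map-+ F G L = interchange (F x) (G x) _ _

  sum-map-* : (c : ℕ) (F : A → ℕ) (L : List A) → sum (map (λ x → c * F x) L) ≡ c * sum (map F L)
  sum-map-* c F [] = sym (*-zeroʳ c)
  sum-map-* c F (x ∷ L) rewrite sum-map-* c F L = sym (*-distribˡ-+ c (F x) _)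

  sum-map-++ : (F : A → ℕ) (xs ys : List A) → sum (map F (xs ++ ys)) ≡ sum (map F xs) + sum (map F ys)
  sum-map-++ F xs ys = trans (cong sum (List.map-++ F xs ys)) (sum-++ (map F xs) (map F ys))

  sum-map-zero : (F : A → ℕ) (L : List A) → (∀ x → F x ≡ 0) → sum (map F L) ≡ 0
  sum-map-zero F [] _ = refl
  sum-map-zero F (x ∷ L) F≡0 rewrite F≡0 x = sum-map-zero F L F≡0

  sum-map-pos : (F : A → ℕ) (L : List A) → 0 < sum (map F L) → ∃ λ x → 0 < F x
  sum-map-pos F [] ()
  sum-map-pos F (x ∷ L) pos with F x ℕ.≟ 0
  ... | no Fx≢0 = x , n≢0⇒n>0 Fx≢0
  ... | yes Fx≡0 rewrite Fx≡0 = sum-map-pos F L pos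

module _ {A B : Set} where

  sum-map-∘ : (F : B → ℕ) (G : A → B) (L : List A) → sum (map F (map G L)) ≡ sum (map (F ∘ G) L)
  sum-map-∘ F G L = cong sum (sym (List.map-∘ L))

  sum-map-concatMap : (F : B → ℕ) (G : A → List B) (L : List A) →
                      sum (map F (concatMap G L)) ≡ sum (map (λ x → sum (map F (G x))) L)
  sum-map-concatMap F G [] = refl
  sum-map-concatMap F G (x ∷ L) rewrite sum-map-++ F (G x) (concatMap G L) | sum-map-concatMap F G L = refl

module _ {A : Set} where

  sum-map-tabulate-member : ∀ {n} (f : Fin n → A) (H : A → ℕ) (i : Fin n) →
                            H (f i) ≤ sum (map H (tabulate f))
  sum-map-tabulate-member f H fzero = m≤m+n _ _
  sum-map-tabulate-member f H (fsuc i) = ≤-trans (sum-map-tabulate-member (f ∘ fsuc) H i) (m≤n+m _ _)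

  sum-map-tabulate-≥ : ∀ {n} (f : Fin n → A) (H : A → ℕ) (c : ℕ) → (∀ i → c ≤ H (f i)) →
                       n * c ≤ sum (map H (tabulate f))
  sum-map-tabulate-≥ {zero} f H c _ = z≤n
  sum-map-tabulate-≥ {suc n} f H c c≤ = +-mono-≤ (c≤ fzero) (sum-map-tabulate-≥ (f ∘ fsuc) H c (c≤ ∘ fsuc))

  sum-map-tabulate-zero : ∀ {n} (f : Fin n → A) (H : A → ℕ) → (∀ i → H (f i) ≡ 0) →
                          sum (map H (tabulate f)) ≡ 0
  sum-map-tabulate-zero {zero} f H _ = refl
  sum-map-tabulate-zero {suc n} f H Hf≡0 rewrite Hf≡0 fzero =
    sum-map-tabulate-zero (f ∘ fsuc) H (Hf≡0 ∘ fsuc)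

count-tabulate-injective : ∀ {n m} (f : Fin n → Fin m) → (∀ {i j} → f i ≡ f j → i ≡ j) → (i₀ : Fin m) →
                           sum (map (λ i → 𝟙 (i Fin.≟ i₀)) (tabulate f)) ≤ 1
count-tabulate-injective {zero} f f-inj i₀ = z≤n
count-tabulate-injective {suc n} f f-inj i₀ with f fzero Fin.≟ i₀
... | yes f0≡i₀ =
  s≤s (≤-reflexive (sum-map-tabulate-zero (f ∘ fsuc) _ (λ i → 𝟙-no (f (fsuc i) Fin.≟ i₀) (≢i₀ i))))
  where
    ≢i₀ : ∀ i → f (fsuc i) ≢ i₀
    ≢i₀ i eq = Fin.0≢1+n (f-inj (trans f0≡i₀ (sym eq)))
... | no _ = count-tabulate-injective (f ∘ fsuc) (Fin.suc-injective ∘ f-inj) i₀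

module _ {k : ℕ} where

  vecs-member≤ : ∀ n (w : Vec (Fin k) n) (H : Vec (Fin k) n → ℕ) → H w ≤ sum (map H (vecs k n))
  vecs-member≤ zero [] H = m≤m+n _ _
  vecs-member≤ (suc n) (i ∷ w) H rewrite sum-map-concatMap H (λ i → map (i ∷_) (vecs k n)) (allFin k) = begin
    H (i ∷ w)                                ≤⟨ vecs-member≤ n w (H ∘ (i ∷_)) ⟩
    sum (map (H ∘ (i ∷_)) (vecs k n))        ≡⟨ sum-map-∘ H (i ∷_) (vecs k n) ⟨
    sum (map H (map (i ∷_) (vecs k n)))      ≤⟨ sum-map-tabulate-member id branchSum i ⟩
    _                                        ∎
    where
      open ≤-Reasoning
      branchSum : Fin k → ℕ
      branchSum j = sum (map H (map (j ∷_) (vecs k n)))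

  _≟ᵃ_ : ∀ {n} (w a : Vec (Fin k) n) → Dec (w ≡ a)
  _≟ᵃ_ = Vec.≡-dec Fin._≟_

  vecs-count≤1 : ∀ n (a : Vec (Fin k) n) → sum (map (λ w → 𝟙 (w ≟ᵃ a)) (vecs k n)) ≤ 1
  vecs-count≤1 zero [] = ≤-refl
  vecs-count≤1 (suc n) (i₀ ∷ a)
    rewrite sum-map-concatMap (λ w → 𝟙 (w ≟ᵃ (i₀ ∷ a))) (λ i → map (i ∷_) (vecs k n)) (allFin k) =
    ≤-trans (sum-map-mono _ _ (allFin k) branch≤) (count-tabulate-injective id id i₀)
    where
      count : Fin k → ℕ
      count i = sum (map (λ w → 𝟙 ((i ∷ w) ≟ᵃ (i₀ ∷ a))) (vecs k n))
      count≤ : ∀ i (d : Dec (i ≡ i₀)) → count i ≤ 𝟙 d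
      count≤ i (yes refl) = ≤-trans (≤-reflexive (cong sum (List.map-cong drop-i (vecs k n)))) (vecs-count≤1 n a)
        where
          drop-i : ∀ w → 𝟙 ((i ∷ w) ≟ᵃ (i ∷ a)) ≡ 𝟙 (w ≟ᵃ a)
          drop-i w = 𝟙-cong ((i ∷ w) ≟ᵃ (i ∷ a)) (w ≟ᵃ a) Vec.∷-injectiveʳ (cong (i ∷_))
      count≤ i (no i≢i₀) =
        ≤-reflexive (sum-map-zero _ (vecs k n) (λ w → 𝟙-no ((i ∷ w) ≟ᵃ (i₀ ∷ a)) (i≢i₀ ∘ Vec.∷-injectiveˡ)))
      branch≤ : ∀ i → sum (map (λ w → 𝟙 (w ≟ᵃ (i₀ ∷ a))) (map (i ∷_) (vecs k n))) ≤ 𝟙 (i Fin.≟ i₀)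
      branch≤ i = ≤-trans (≤-reflexive (sum-map-∘ _ (i ∷_) (vecs k n))) (count≤ i (i Fin.≟ i₀))

  vecs-countExtensions≥ : ∀ j {n} (a : Vec (Fin k) n) →
                          k ^ j ≤ sum (map (λ w → 𝟙 (Extends? a w)) (vecs k (j + n)))
  vecs-countExtensions≥ zero a =
    ≤-trans (≤-reflexive (sym (𝟙-yes (Extends? a a) (0 , here)))) (vecs-member≤ _ a _)
  vecs-countExtensions≥ (suc j) {n} a
    rewrite sum-map-concatMap (λ w → 𝟙 (Extends? a w)) (λ i → map (i ∷_) (vecs k (j + n))) (allFin k) =
    sum-map-tabulate-≥ id _ (k ^ j) branch≥
    where
      extend : ∀ i w → ∃ (Extends a w) → ∃ (Extends a (i ∷ w))
      extend i w (e , E) = suc e , there i E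
      branch≥ : ∀ i → k ^ j ≤ sum (map (λ w → 𝟙 (Extends? a w)) (map (i ∷_) (vecs k (j + n))))
      branch≥ i = begin
        k ^ j                                                       ≤⟨ vecs-countExtensions≥ j a ⟩
        sum (map (λ w → 𝟙 (Extends? a w)) (vecs k (j + n)))         ≤⟨ sum-map-mono _ _ (vecs k (j + n)) extend≥ ⟩
        sum (map (λ w → 𝟙 (Extends? a (i ∷ w))) (vecs k (j + n)))   ≡⟨ sum-map-∘ _ (i ∷_) (vecs k (j + n)) ⟨
        _                                                           ∎
        where
          open ≤-Reasoning
          extend≥ : ∀ w → 𝟙 (Extends? a w) ≤ 𝟙 (Extends? a (i ∷ w))
          extend≥ w = 𝟙-mono (Extends? a w) (Extends? a (i ∷ w)) (extend i w)

module _ {k h : ℕ} where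

  Σᵥ : (Vertex k h → ℕ) → ℕ
  Σᵥ F = sum (map F (allVertices k h))

  sum-levels-suc : (F : Vertex k h → ℕ) (n : ℕ) (p : suc n ≤ h) →
                   sum (map F (levels k h (suc n) p)) ≡
                   sum (map F (levels k h n (≤-trans (n≤1+n n) p))) + sum (map (F ∘ vtx (suc n) p) (vecs k (suc n)))
  sum-levels-suc F n p = trans (sum-map-++ F (levels k h n _) (map (vtx (suc n) p) (vecs k (suc n))))
                               (cong (sum (map F (levels k h n _)) +_) (sum-map-∘ F (vtx (suc n) p) (vecs k (suc n))))

  module _ (F : Vertex k h → ℕ) (D : ℕ) (F-onLevel : ∀ x → depth x ≢ D → F x ≡ 0) where

    levelSum-off : ∀ n (p : n ≤ h) → n ≢ D → sum (map (F ∘ vtx n p) (vecs k n)) ≡ 0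
    levelSum-off n p n≢D = sum-map-zero _ (vecs k n) (λ w → F-onLevel (vtx n p w) n≢D)

    sum-levels-below : ∀ n (p : n ≤ h) → n < D → sum (map F (levels k h n p)) ≡ 0
    sum-levels-below zero p 0<D = trans (sum-map-∘ F (vtx zero p) (vecs k zero)) (levelSum-off zero p (<⇒≢ 0<D))
    sum-levels-below (suc n) p n<D rewrite sum-levels-suc F n p
      | sum-levels-below n (≤-trans (n≤1+n n) p) (<-trans (n<1+n n) n<D) = levelSum-off (suc n) p (<⇒≢ n<D)

    sum-levels-above : ∀ n (p : n ≤ h) .(pD : D ≤ h) → D ≤ n →
                       sum (map F (levels k h n p)) ≡ sum (map (F ∘ vtx D pD) (vecs k D))
    sum-levels-above zero p pD z≤n = sum-map-∘ F (vtx zero p) (vecs k zero)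
    sum-levels-above (suc n) p pD D≤n with D ℕ.≟ suc n
    ... | yes refl rewrite sum-levels-suc F n p | sum-levels-below n (≤-trans (n≤1+n n) p) ≤-refl = refl
    ... | no D≢1+n rewrite sum-levels-suc F n p | levelSum-off (suc n) p (D≢1+n ∘ sym)
      | sum-levels-above n (≤-trans (n≤1+n n) p) pD (≤-pred (≤∧≢⇒< D≤n D≢1+n)) = +-identityʳ _

    Σᵥ-onLevel : .(pD : D ≤ h) → Σᵥ F ≡ sum (map (F ∘ vtx D pD) (vecs k D))
    Σᵥ-onLevel pD = sum-levels-above h ≤-refl pD (recompute (D ≤? h) pD)

  sum-levels-member : (F : Vertex k h → ℕ) (n : ℕ) (p : n ≤ h) (v : Vertex k h) → depth v ≤ n →
                      F v ≤ sum (map F (levels k h n p))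
  sum-levels-member F zero p (vtx .zero q []) z≤n = m≤m+n _ _
  sum-levels-member F (suc n) p (vtx D q w) D≤1+n rewrite sum-levels-suc F n p with D ℕ.≟ suc n
  ... | yes refl = ≤-trans (vecs-member≤ (suc n) w (F ∘ vtx (suc n) p)) (m≤n+m _ _)
  ... | no D≢1+n =
    ≤-trans (sum-levels-member F n (≤-trans (n≤1+n n) p) (vtx D q w) (≤-pred (≤∧≢⇒< D≤1+n D≢1+n))) (m≤m+n _ _)

  Σᵥ-member : (F : Vertex k h → ℕ) (v : Vertex k h) → F v ≤ Σᵥ F
  Σᵥ-member F v = sum-levels-member F h ≤-refl v (depth≤height v)

  Σᵥ-zero⇒zero : (F : Vertex k h → ℕ) → Σᵥ F ≡ 0 → ∀ v → F v ≡ 0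
  Σᵥ-zero⇒zero F ΣF≡0 v = n≤0⇒n≡0 (≤-trans (Σᵥ-member F v) (≤-reflexive ΣF≡0))

  δ : Vertex k h → Vertex k h → ℕ
  δ v x = 𝟙 (x ≟ᵥ v)

  Σᵥ-δ≥1 : (v : Vertex k h) → 1 ≤ Σᵥ (δ v)
  Σᵥ-δ≥1 v = ≤-trans (≤-reflexive (sym (𝟙-yes (v ≟ᵥ v) refl))) (Σᵥ-member (δ v) v)

  Σᵥ-δ≤1 : (v : Vertex k h) → Σᵥ (δ v) ≤ 1
  Σᵥ-δ≤1 v@(vtx D q a) = begin
    Σᵥ (δ v)                                            ≡⟨ Σᵥ-onLevel (δ v) D δ-onLevel q ⟩
    sum (map (λ w → δ v (vtx D q w)) (vecs k D))        ≡⟨ cong sum (List.map-cong δ-onLevel≡ (vecs k D)) ⟩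
    sum (map (λ w → 𝟙 (w ≟ᵃ a)) (vecs k D))             ≤⟨ vecs-count≤1 D a ⟩
    1                                                   ∎
    where
      open ≤-Reasoning
      δ-onLevel : ∀ x → depth x ≢ D → δ v x ≡ 0
      δ-onLevel x d≢D = 𝟙-no (x ≟ᵥ v) (d≢D ∘ cong depth)
      δ-onLevel≡ : ∀ w → δ v (vtx D q w) ≡ 𝟙 (w ≟ᵃ a)
      δ-onLevel≡ w = 𝟙-cong (vtx D q w ≟ᵥ v) (w ≟ᵃ a) vtx-injective (λ { refl → refl })

-- Exchanging a region below a vertex for a layer of power-1 broadcasts

module _ {k h : ℕ} where

  InRegion : Vertex k h → ℕ → Vertex k h → Set
  InRegion a D x = ∃ (InSubtree a x) × depth x ≤ D

  inRegion? : (a : Vertex k h) (D : ℕ) (x : Vertex k h) → Dec (InRegion a D x)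
  inRegion? a D x = Extends? (addr a) (addr x) ×-dec (depth x ≤? D)

  surgery : (Vertex k h → ℕ) → Vertex k h → ℕ → Vertex k h → ℕ
  surgery f a D x with inRegion? a D x
  ... | yes _ = 𝟙 (depth x ℕ.≟ D)
  ... | no _ = f x

  surgery-in : ∀ f a D x → InRegion a D x → surgery f a D x ≡ 𝟙 (depth x ℕ.≟ D)
  surgery-in f a D x x∈ with inRegion? a D x
  ... | yes _ = refl
  ... | no x∉ = ⊥-elim (x∉ x∈)

  surgery-out : ∀ f a D x → ¬ InRegion a D x → surgery f a D x ≡ f x
  surgery-out f a D x x∉ with inRegion? a D x
  ... | yes x∈ = ⊥-elim (x∉ x∈)
  ... | no _ = refl

  -- layer a D is the indicator of the descendants of a at depth D.
  layer : Vertex k h → ℕ → Vertex k h → ℕ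
  layer = surgery (λ _ → 0)

  Σᵥ-layer≥ : (a : Vertex k h) (j D : ℕ) → j + depth a ≡ D → D ≤ h → k ^ j ≤ Σᵥ (layer a D)
  Σᵥ-layer≥ a j D refl D≤h = begin
    k ^ j                                                 ≤⟨ vecs-countExtensions≥ j (addr a) ⟩
    sum (map (λ w → 𝟙 (Extends? (addr a) w)) (vecs k D))  ≡⟨ cong sum (List.map-cong layer-onLevel (vecs k D)) ⟨
    sum (map (layer a D ∘ vtx D D≤h) (vecs k D))          ≡⟨ Σᵥ-onLevel (layer a D) D layer-offLevel D≤h ⟨
    Σᵥ (layer a D)                                        ∎
    where
      open ≤-Reasoning
      layer-offLevel : ∀ x → depth x ≢ D → layer a D x ≡ 0
      layer-offLevel x d≢D with inRegion? a D x
      ... | yes _ = 𝟙-no (depth x ℕ.≟ D) d≢D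
      ... | no _ = refl
      layer-onLevel : ∀ w → layer a D (vtx D D≤h w) ≡ 𝟙 (Extends? (addr a) w)
      layer-onLevel w with inRegion? a D (vtx D D≤h w)
      ... | yes (E , _) = trans (𝟙-yes (D ℕ.≟ D) refl) (sym (𝟙-yes (Extends? (addr a) w) E))
      ... | no ¬R = sym (𝟙-no (Extends? (addr a) w) (λ E → ¬R (E , ≤-refl)))

  big : (Vertex k h → ℕ) → Vertex k h → ℕ
  big f x = 𝟙 (2 ≤? f x)

  Σᵥ-big≥1 : (f : Vertex k h → ℕ) (v : Vertex k h) → 2 ≤ f v → 1 ≤ Σᵥ (big f)
  Σᵥ-big≥1 f v fv≥2 = ≤-trans (≤-reflexive (sym (𝟙-yes (2 ≤? f v) fv≥2))) (Σᵥ-member (big f) v)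

  -- Independence survives because a walk between the new layer and a broadcaster outside the subtree
  -- of a passes through a, and hence lies within the range of v₀ (leaveSubtreeFrom).
  module Surgery (f : Vertex k h → ℕ) (f-ib : IsIndepBroadcast f) (a v₀ : Vertex k h) (D : ℕ) (D≥1 : 1 ≤ D)
                 {e₀ : ℕ} (v₀∈ : InSubtree a v₀ e₀) (v₀≤D : depth v₀ ≤ D) (fv₀>0 : 0 < f v₀)
                 (only-v₀ : ∀ y → ∃ (InSubtree a y) → depth y ≤ suc D → 0 < f y → y ≡ v₀)
                 (deep≤1 : ∀ y → ∃ (InSubtree a y) → suc D < depth y → f y ≤ 1) where

    g : Vertex k h → ℕ
    g = surgery f a D

    private
      f-indep : IsIndependent f
      f-indep = proj₂ f-ib

      g-out : ∀ x → ¬ InRegion a D x → g x ≡ f x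
      g-out = surgery-out f a D

      v₀∈region : InRegion a D v₀
      v₀∈region = (_ , v₀∈) , v₀≤D

    g≤1-in : ∀ x → InRegion a D x → g x ≤ 1
    g≤1-in x x∈ rewrite surgery-in f a D x x∈ = 𝟙≤1 (depth x ℕ.≟ D)

    g>0-in⇒depth≡ : ∀ x → InRegion a D x → 0 < g x → depth x ≡ D
    g>0-in⇒depth≡ x x∈ gx>0 rewrite surgery-in f a D x x∈ = 𝟙>0⇒ (depth x ℕ.≟ D) gx>0

    outsideBroadcaster : ∀ x → ¬ InRegion a D x → 0 < f x →
                         NotInSubtree a x ⊎ (suc (suc D) ≤ depth x × f x ≤ 1)
    outsideBroadcaster x x∉ fx>0 with Extends? (addr a) (addr x)
    ... | no x∉T = inj₁ (λ e E → x∉T (e , E))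
    ... | yes E with depth x ≤? D
    ...   | yes x≤D = ⊥-elim (x∉ (E , x≤D))
    ...   | no x≰D with depth x ℕ.≟ suc D
    ...     | yes x≡1+D = ⊥-elim (x≰D (subst (λ z → depth z ≤ D) (sym x≡v₀) v₀≤D))
      where
        x≡v₀ : x ≡ v₀
        x≡v₀ = only-v₀ x E (≤-reflexive x≡1+D) fx>0
    ...     | no x≢1+D = inj₂ (1+D<x , deep≤1 x E 1+D<x)
      where
        1+D<x : suc D < depth x
        1+D<x = ≤∧≢⇒< (≰⇒> x≰D) (x≢1+D ∘ sym)

    g-isBroadcast : IsBroadcast g
    g-isBroadcast v = byRegion (inRegion? a D v)
      where
        rootFar : (d : Dec (depth v ≡ D)) → DistGe root v (𝟙 d)
        rootFar (yes v≡D) zero _ W = <-irrefl (trans (cong depth (Walk₀⇒≡ W)) v≡D) D≥1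
        rootFar (yes _) (suc n) (s≤s ()) _
        rootFar (no _) n ()
        byRegion : Dec (InRegion a D v) → ∃ λ u → DistGe u v (g v)
        byRegion (yes v∈) rewrite surgery-in f a D v v∈ = root , rootFar (depth v ℕ.≟ D)
        byRegion (no v∉) rewrite g-out v v∉ = proj₁ f-ib v

    layerOffset≥ : ∀ {s eₛ} → InSubtree a s eₛ → depth s ≡ D → e₀ ≤ eₛ
    layerOffset≥ {s} {eₛ} s∈ s≡D = +-cancelʳ-≤ (depth a) e₀ eₛ
      (subst₂ _≤_ (InSubtree-depth {a = a} {x = v₀} v₀∈)
                  (trans (sym s≡D) (InSubtree-depth {a = a} {x = s} s∈)) v₀≤D)

    notInSubtree⇒≢v₀ : ∀ {x} → NotInSubtree a x → x ≢ v₀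
    notInSubtree⇒≢v₀ x∉ refl = x∉ _ v₀∈

    layerHears⇒⊥ : ∀ {u v n} → InRegion a D u → 0 < g u → ¬ InRegion a D v → 0 < f v →
                   n ≤ f v → Walk u v n → ⊥
    layerHears⇒⊥ {u} {v} u∈@((_ , U) , _) gu>0 v∉ fv>0 n≤ W with outsideBroadcaster v v∉ fv>0
    ... | inj₁ v∉T with leaveSubtreeFrom {a = a} {x = v} {v = v₀} {s = u} v∉T v₀∈ U
                          (layerOffset≥ {u} U (g>0-in⇒depth≡ u u∈ gu>0)) W
    ...   | n′ , n′≤n , W′ = notInSubtree⇒≢v₀ v∉T (sym (f-indep v₀ v fv₀>0 fv>0 (n′ , ≤-trans n′≤n n≤ , W′)))
    layerHears⇒⊥ {u} {v} {n} u∈ gu>0 v∉ fv>0 n≤ W | inj₂ (deep , fv≤1) = 1+n≰n (begin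
      suc (suc D)   ≤⟨ deep ⟩
      depth v       ≤⟨ Walk-depth≥ W ⟩
      n + depth u   ≤⟨ +-mono-≤ (≤-trans n≤ fv≤1) (≤-reflexive (g>0-in⇒depth≡ u u∈ gu>0)) ⟩
      suc D         ∎)
      where open ≤-Reasoning

    layerHeard⇒⊥ : ∀ {u v n} → ¬ InRegion a D u → 0 < f u → InRegion a D v → 0 < g v →
                   n ≤ g v → Walk u v n → ⊥
    layerHeard⇒⊥ {u} {v} {n} u∉ fu>0 v∈@((_ , V) , _) gv>0 n≤ W with outsideBroadcaster u u∉ fu>0
    ... | inj₁ u∉T with leaveSubtreeFrom {a = a} {x = u} {v = v₀} {s = v} u∉T v₀∈ V
                          (layerOffset≥ {v} V (g>0-in⇒depth≡ v v∈ gv>0)) (reverseʷ W)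
    ...   | n′ , n′≤n , W′ = notInSubtree⇒≢v₀ u∉T (f-indep u v₀ fu>0 fv₀>0 (n′ , n′≤fv₀ , reverseʷ W′))
      where
        n′≤fv₀ : n′ ≤ f v₀
        n′≤fv₀ = ≤-trans n′≤n (≤-trans n≤ (≤-trans (g≤1-in v v∈) fv₀>0))
    layerHeard⇒⊥ {u} {v} {n} u∉ fu>0 v∈ gv>0 n≤ W | inj₂ (deep , _) = 1+n≰n (begin
      suc (suc D)   ≤⟨ deep ⟩
      depth u       ≤⟨ Walk-depth≤ W ⟩
      n + depth v   ≤⟨ +-mono-≤ (≤-trans n≤ (g≤1-in v v∈)) (≤-reflexive (g>0-in⇒depth≡ v v∈ gv>0)) ⟩
      suc D         ∎)
      where open ≤-Reasoning

    g-isIndependent : IsIndependent g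
    g-isIndependent u v gu>0 gv>0 (n , n≤ , W) = byRegion (inRegion? a D u) (inRegion? a D v)
      where
        byRegion : Dec (InRegion a D u) → Dec (InRegion a D v) → u ≡ v
        byRegion (yes u∈) (yes v∈) = Walk≤1-sameDepth⇒≡ (≤-trans n≤ (g≤1-in v v∈)) W
          (trans (g>0-in⇒depth≡ u u∈ gu>0) (sym (g>0-in⇒depth≡ v v∈ gv>0)))
        byRegion (yes u∈) (no v∉) rewrite g-out v v∉ = ⊥-elim (layerHears⇒⊥ u∈ gu>0 v∉ gv>0 n≤ W)
        byRegion (no u∉) (yes v∈) rewrite g-out u u∉ = ⊥-elim (layerHeard⇒⊥ u∉ gu>0 v∈ gv>0 n≤ W)
        byRegion (no u∉) (no v∉) rewrite g-out u u∉ | g-out v v∉ = f-indep u v gu>0 gv>0 (n , n≤ , W)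

    g-isIndepBroadcast : IsIndepBroadcast g
    g-isIndepBroadcast = g-isBroadcast , g-isIndependent

    -- Inside the region f vanishes except at v₀, so f + layer is at most g plus the lost value f v₀.
    surgery-pointwise : ∀ x → f x + layer a D x ≤ g x + f v₀ * δ v₀ x
    surgery-pointwise x = byRegion (inRegion? a D x)
      where
        byRegion : Dec (InRegion a D x) → f x + layer a D x ≤ g x + f v₀ * δ v₀ x
        byRegion (no x∉) rewrite g-out x x∉ | surgery-out (λ _ → 0) a D x x∉ =
          ≤-trans (≤-reflexive (+-identityʳ (f x))) (m≤m+n _ _)
        byRegion (yes x∈@((_ , E) , x≤D))
          rewrite surgery-in f a D x x∈ | surgery-in (λ _ → 0) a D x x∈ with x ≟ᵥ v₀
        ... | yes refl rewrite *-identityʳ (f x) = ≤-reflexive (+-comm (f x) _)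
        ... | no x≢v₀ rewrite *-zeroʳ (f v₀) | +-identityʳ (𝟙 (depth x ℕ.≟ D)) with f x ℕ.≟ 0
        ...   | yes fx≡0 rewrite fx≡0 = ≤-refl
        ...   | no fx≢0 = ⊥-elim (x≢v₀ (only-v₀ x (_ , E) (≤-trans x≤D (n≤1+n D)) (n≢0⇒n>0 fx≢0)))

    surgery-weight : Σᵥ f + Σᵥ (layer a D) ≤ Σᵥ g + f v₀
    surgery-weight = begin
      Σᵥ f + Σᵥ (layer a D)              ≡⟨ sum-map-+ f (layer a D) (allVertices k h) ⟨
      Σᵥ (λ x → f x + layer a D x)       ≤⟨ sum-map-mono _ _ (allVertices k h) surgery-pointwise ⟩
      Σᵥ (λ x → g x + f v₀ * δ v₀ x)     ≡⟨ sum-map-+ g (λ x → f v₀ * δ v₀ x) (allVertices k h) ⟩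
      Σᵥ g + Σᵥ (λ x → f v₀ * δ v₀ x)    ≡⟨ cong (Σᵥ g +_) (sum-map-* (f v₀) (δ v₀) (allVertices k h)) ⟩
      Σᵥ g + f v₀ * Σᵥ (δ v₀)            ≤⟨ +-monoʳ-≤ (Σᵥ g) (*-monoʳ-≤ (f v₀) (Σᵥ-δ≤1 v₀)) ⟩
      Σᵥ g + f v₀ * 1                    ≡⟨ cong (Σᵥ g +_) (*-identityʳ (f v₀)) ⟩
      Σᵥ g + f v₀                        ∎
      where open ≤-Reasoning

    surgery-improves : f v₀ < Σᵥ (layer a D) → Σᵥ f < Σᵥ g
    surgery-improves fv₀<L = +-cancelʳ-< (f v₀) (Σᵥ f) (Σᵥ g)
      (≤-trans (≤-reflexive (sym (+-suc (Σᵥ f) (f v₀)))) (≤-trans (+-monoʳ-≤ (Σᵥ f) fv₀<L) surgery-weight))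

    surgery-keeps : f v₀ ≤ Σᵥ (layer a D) → Σᵥ f ≤ Σᵥ g
    surgery-keeps fv₀≤L = +-cancelʳ-≤ (f v₀) (Σᵥ f) (Σᵥ g) (≤-trans (+-monoʳ-≤ (Σᵥ f) fv₀≤L) surgery-weight)

    g≥2⇒f≥2 : ∀ x → 2 ≤ g x → 2 ≤ f x
    g≥2⇒f≥2 x gx≥2 = byRegion (inRegion? a D x)
      where
        byRegion : Dec (InRegion a D x) → 2 ≤ f x
        byRegion (yes x∈) = ⊥-elim (1+n≰n (≤-trans gx≥2 (g≤1-in x x∈)))
        byRegion (no x∉) = subst (2 ≤_) (g-out x x∉) gx≥2

    big-pointwise : 2 ≤ f v₀ → ∀ x → big g x + δ v₀ x ≤ big f x
    big-pointwise fv₀≥2 x with x ≟ᵥ v₀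
    ... | yes refl rewrite 𝟙-no (2 ≤? g v₀) (λ gv₀≥2 → 1+n≰n (≤-trans gv₀≥2 (g≤1-in v₀ v₀∈region)))
                         | 𝟙-yes (2 ≤? f v₀) fv₀≥2 = ≤-refl
    ... | no _ rewrite +-identityʳ (big g x) = 𝟙-mono (2 ≤? g x) (2 ≤? f x) (g≥2⇒f≥2 x)

    surgery-fewerBig : 2 ≤ f v₀ → Σᵥ (big g) < Σᵥ (big f)
    surgery-fewerBig fv₀≥2 = begin-strict
      Σᵥ (big g)                    <⟨ m<m+n _ (Σᵥ-δ≥1 v₀) ⟩
      Σᵥ (big g) + Σᵥ (δ v₀)        ≡⟨ sum-map-+ (big g) (δ v₀) (allVertices k h) ⟨
      Σᵥ (λ x → big g x + δ v₀ x)   ≤⟨ sum-map-mono _ _ (allVertices k h) (big-pointwise fv₀≥2) ⟩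
      Σᵥ (big f)                    ∎
      where open ≤-Reasoning

-- Improving a broadcast

1+2n≤3^n : ∀ n → suc (n + n) ≤ 3 ^ n
1+2n≤3^n zero = ≤-refl
1+2n≤3^n (suc n) = begin
  suc (suc n + suc n)         ≡⟨ shift n ⟩
  suc (n + n) + (1 + (1 + 0)) ≤⟨ +-mono-≤ ih (+-mono-≤ 1≤3^n (+-mono-≤ 1≤3^n z≤n)) ⟩
  3 ^ suc n                   ∎
  where
    open ≤-Reasoning
    ih = 1+2n≤3^n n
    1≤3^n = ≤-trans (s≤s z≤n) ih
    shift : ∀ n → suc (suc n + suc n) ≡ suc (n + n) + (1 + (1 + 0))
    shift = solve-∀

2+2n≤3^n : ∀ n → 2 ≤ n → suc (suc (n + n)) ≤ 3 ^ n
2+2n≤3^n (suc zero) (s≤s ())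
2+2n≤3^n (suc (suc n)) _ = from2 n
  where
    from2 : ∀ n → suc (suc (suc (suc n) + suc (suc n))) ≤ 3 ^ suc (suc n)
    from2 zero = s≤s (s≤s (s≤s (s≤s (s≤s (s≤s z≤n)))))
    from2 (suc n) = begin
      suc (suc (suc (suc (suc n)) + suc (suc (suc n))))     ≡⟨ shift n ⟩
      suc (suc (suc (suc n) + suc (suc n))) + (1 + (1 + 0)) ≤⟨ +-mono-≤ ih (+-mono-≤ 1≤3^n (+-mono-≤ 1≤3^n z≤n)) ⟩
      3 ^ suc (suc (suc n))                                 ∎
      where
        open ≤-Reasoning
        ih = from2 n
        1≤3^n = ≤-trans (s≤s z≤n) ih
        shift : ∀ n → suc (suc (suc (suc (suc n)) + suc (suc (suc n)))) ≡
                      suc (suc (suc (suc n) + suc (suc n))) + (1 + (1 + 0))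
        shift = solve-∀

module _ {k : ℕ} (k≥3 : 3 ≤ k) where

  2+r≤k^r : ∀ r → 1 ≤ r → suc (suc r) ≤ k ^ r
  2+r≤k^r (suc r) _ = begin
    suc (suc (suc r))     ≤⟨ m≤m+n _ r ⟩
    suc (suc (suc r)) + r ≡⟨ shift r ⟨
    suc (suc r + suc r)   ≤⟨ 1+2n≤3^n (suc r) ⟩
    3 ^ suc r             ≤⟨ ^-monoˡ-≤ (suc r) k≥3 ⟩
    k ^ suc r             ∎
    where
      open ≤-Reasoning
      shift : ∀ r → suc (suc r + suc r) ≡ suc (suc (suc r)) + r
      shift = solve-∀

  k^1>2 : 2 < k ^ 1
  k^1>2 = ≤-trans k≥3 (≤-reflexive (sym (*-identityʳ k)))

  private
    spread : ∀ m t → suc (m + (t + t)) ≤ suc ((m + t) + (m + t))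
    spread m t = s≤s (≤-trans (m≤m+n _ m) (≤-reflexive (shift m t)))
      where
        shift : ∀ m t → m + (t + t) + m ≡ (m + t) + (m + t)
        shift = solve-∀

    <k^[m+t]-large : ∀ r m t → 2 ≤ m + t → r ≤ suc (m + (t + t)) → r < k ^ (m + t)
    <k^[m+t]-large r m t n≥2 r≤ = begin-strict
      r                             ≤⟨ ≤-trans r≤ (spread m t) ⟩
      suc ((m + t) + (m + t))       <⟨ 2+2n≤3^n (m + t) n≥2 ⟩
      3 ^ (m + t)                   ≤⟨ ^-monoˡ-≤ (m + t) k≥3 ⟩
      k ^ (m + t)                   ∎
      where open ≤-Reasoning

  <k^[m+t]-or-exception : ∀ r m t → 2 ≤ r → r ≤ suc (m + (t + t)) → r < k ^ (m + t) ⊎ (m ≡ 0 × t ≡ 1 × r ≡ 3)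
  <k^[m+t]-or-exception r zero zero r≥2 r≤1 = ⊥-elim (1+n≰n (≤-trans r≥2 r≤1))
  <k^[m+t]-or-exception r zero (suc zero) r≥2 r≤3 with r ℕ.≟ 3
  ... | yes r≡3 = inj₂ (refl , refl , r≡3)
  ... | no r≢3 = inj₁ (≤-trans (≤∧≢⇒< r≤3 r≢3) k^1>2)
  <k^[m+t]-or-exception r (suc zero) zero r≥2 r≤2 = inj₁ (≤-trans (s≤s r≤2) k^1>2)
  <k^[m+t]-or-exception r zero (suc (suc t)) _ r≤ = inj₁ (<k^[m+t]-large r zero (suc (suc t)) (s≤s (s≤s z≤n)) r≤)
  <k^[m+t]-or-exception r (suc m) (suc t) _ r≤ =
    inj₁ (<k^[m+t]-large r (suc m) (suc t) (s≤s (≤-trans (s≤s z≤n) (≤-reflexive (sym (+-suc m t))))) r≤)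
  <k^[m+t]-or-exception r (suc (suc m)) zero _ r≤ = inj₁ (<k^[m+t]-large r (suc (suc m)) zero (s≤s (s≤s z≤n)) r≤)

-- t is the largest value ≤ d with t + t ≤ s.
largestHalf : ∀ d s → ∃ λ t → t ≤ d × t + t ≤ s × (t ≡ d ⊎ s < suc (suc (t + t)))
largestHalf zero s = 0 , z≤n , z≤n , inj₁ refl
largestHalf (suc d) s with largestHalf d s
... | t , t≤d , 2t≤s , inj₂ s<2t+2 = t , m≤n⇒m≤1+n t≤d , 2t≤s , inj₂ s<2t+2
... | t , t≤d , 2t≤s , inj₁ refl with suc t + suc t ≤? s
...   | yes 2t+2≤s = suc t , ≤-refl , 2t+2≤s , inj₁ refl
...   | no 2t+2≰s = t , n≤1+n t , 2t≤s , inj₂ (≤-trans (≰⇒> 2t+2≰s) (≤-reflexive (cong suc (+-suc t t))))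

module _ {k h : ℕ} where

  Improvable : (Vertex k h → ℕ) → Set
  Improvable f = Σ[ g ∈ (Vertex k h → ℕ) ] IsIndepBroadcast g × Σᵥ f < Σᵥ g

  ImprovableIfBig : (Vertex k h → ℕ) → Set
  ImprovableIfBig f = IsIndepBroadcast f → ∀ v → 2 ≤ f v → Improvable f

  ∃ᵥ? : {P : Vertex k h → Set} → (∀ x → Dec (P x)) → Dec (∃ P)
  ∃ᵥ? P? with Σᵥ (λ x → 𝟙 (P? x)) ℕ.≟ 0
  ... | yes Σ≡0 = no λ (x , Px) → 1+n≢0 (trans (sym (𝟙-yes (P? x) Px)) (Σᵥ-zero⇒zero _ Σ≡0 x))
  ... | no Σ≢0 with sum-map-pos (λ x → 𝟙 (P? x)) (allVertices k h) (n≢0⇒n>0 Σ≢0)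
  ...   | x , pos = yes (x , 𝟙>0⇒ (P? x) pos)

  broadcast≤ecc : (f : Vertex k h → ℕ) → IsBroadcast f → ∀ v → f v ≤ h + depth v
  broadcast≤ecc f f-bc v with f v ≤? h + depth v
  ... | yes fv≤ = fv≤
  ... | no fv≰ with f-bc v
  ...   | u , far = ⊥-elim (far _ du+dv<fv (walkThroughRoot u v))
    where
      du+dv<fv : depth u + depth v < f v
      du+dv<fv = ≤-trans (s≤s (+-monoˡ-≤ (depth v) (depth≤height u))) (≰⇒> fv≰)

  deepestBig : (f : Vertex k h → ℕ) → ∀ fuel v → 2 ≤ f v → h ∸ depth v ≤ fuel →
               ∃ λ w → 2 ≤ f w × (∀ y → depth w < depth y → f y ≤ 1)
  deepestBig f fuel v fv≥2 bound with ∃ᵥ? (λ y → (2 ≤? f y) ×-dec (suc (depth v) ≤? depth y))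
  ... | no ∄deeper = v , fv≥2 , λ y v<y → ≤-pred (≰⇒> (λ fy≥2 → ∄deeper (y , fy≥2 , v<y)))
  ... | yes (y , fy≥2 , v<y) with fuel
  ...   | zero = ⊥-elim (<⇒≱ v<y (≤-trans (depth≤height y) (m∸n≡0⇒m≤n (n≤0⇒n≡0 bound))))
  ...   | suc fuel = deepestBig f fuel y fy≥2 (≤-pred (≤-trans (∸-monoʳ-< v<y (depth≤height y)) bound))

  module Activate (g : Vertex k h → ℕ) (g-ib : IsIndepBroadcast g) (g≤1 : ∀ x → g x ≤ 1)
                  (b : Vertex k h) (gb≡0 : g b ≡ 0) (silentNbrs : ∀ y → Adj y b → g y ≡ 0)
                  (z : Vertex k h) (z≢b : depth z ≢ depth b) where

    g′ : Vertex k h → ℕ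
    g′ x = δ b x + g x

    g′-isBroadcast : IsBroadcast g′
    g′-isBroadcast v with v ≟ᵥ b
    ... | yes refl rewrite gb≡0 = z , λ { zero _ W → z≢b (cong depth (Walk₀⇒≡ W)) ; (suc n) (s≤s ()) _ }
    ... | no _ = proj₁ g-ib v

    g′-isIndependent : IsIndependent g′
    g′-isIndependent u v g′u>0 g′v>0 (n , n≤ , W) with u ≟ᵥ b | v ≟ᵥ b
    ... | yes refl | yes refl = refl
    ... | no _ | no _ = proj₂ g-ib u v g′u>0 g′v>0 (n , n≤ , W)
    ... | yes refl | no _ = fromB (≤-trans n≤ (g≤1 v)) W
      where
        fromB : ∀ {n} → n ≤ 1 → Walk b v n → b ≡ v
        fromB _ nil = refl
        fromB (s≤s z≤n) (cons adj nil) = ⊥-elim (<-irrefl (sym (silentNbrs v (Adj-sym adj))) g′v>0)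
    ... | no _ | yes refl = toB (subst (λ q → n ≤ 1 + q) gb≡0 n≤) W
      where
        toB : ∀ {n} → n ≤ 1 → Walk u b n → u ≡ b
        toB _ nil = refl
        toB (s≤s z≤n) (cons adj nil) = ⊥-elim (<-irrefl (sym (silentNbrs u adj)) g′u>0)

    g′-isIndepBroadcast : IsIndepBroadcast g′
    g′-isIndepBroadcast = g′-isBroadcast , g′-isIndependent

    g′-heavier : Σᵥ g < Σᵥ g′
    g′-heavier = ≤-trans (+-monoˡ-≤ (Σᵥ g) (Σᵥ-δ≥1 b)) (≤-reflexive (sym (sum-map-+ (δ b) g (allVertices k h))))

module _ {k h : ℕ} (k≥3 : 3 ≤ k) (h≥1 : 1 ≤ h) where

  module _ (f : Vertex k h → ℕ) (f-ib : IsIndepBroadcast f) (v₀ : Vertex k h) (fv₀≥2 : 2 ≤ f v₀) where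

    private
      d = depth v₀
      fv₀>0 : 0 < f v₀
      fv₀>0 = ≤-trans (n≤1+n 1) fv₀≥2
      m = h ∸ d
      m+d≡h : m + d ≡ h
      m+d≡h = m∸n+n≡m (depth≤height v₀)

    -- The subtree of v₀ is deep enough: lay 1's on all k ^ (f v₀ - 1) descendants at distance f v₀ - 1.
    improve-shallow : (∀ y → d < depth y → f y ≤ 1) → f v₀ ≤ m → Improvable f
    improve-shallow deeper≤1 fv₀≤m = S.g , S.g-isIndepBroadcast , S.surgery-improves fv₀<layer
      where
        r = f v₀ ∸ 1
        1+r≡fv₀ : suc r ≡ f v₀
        1+r≡fv₀ = m+[n∸m]≡n fv₀>0
        D = d + r
        D≤h : D ≤ h
        D≤h = ≤-trans (+-monoʳ-≤ d (≤-trans (n≤1+n r) (≤-trans (≤-reflexive 1+r≡fv₀) fv₀≤m)))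
                      (≤-reflexive (m+[n∸m]≡n (depth≤height v₀)))
        only-v₀ : ∀ y → ∃ (InSubtree v₀ y) → depth y ≤ suc D → 0 < f y → y ≡ v₀
        only-v₀ y (e , y∈) y≤1+D fy>0 = proj₂ f-ib y v₀ fy>0 fv₀>0 (e , e≤fv₀ , ascentWalk v₀ y y∈)
          where
            e≤fv₀ : e ≤ f v₀
            e≤fv₀ = subst (e ≤_) 1+r≡fv₀ (+-cancelʳ-≤ d e (suc r)
                      (subst₂ _≤_ (InSubtree-depth {a = v₀} {x = y} y∈) (cong suc (+-comm d r)) y≤1+D))
        r≥1 : 1 ≤ r
        r≥1 = ∸-monoˡ-≤ 1 fv₀≥2
        module S = Surgery f f-ib v₀ v₀ D (≤-trans r≥1 (m≤n+m r d)) here (m≤m+n d r) fv₀>0 only-v₀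
                           (λ y _ 1+D<y → deeper≤1 y (≤-trans (s≤s (≤-trans (m≤m+n d r) (n≤1+n _))) 1+D<y))
        fv₀<layer : f v₀ < Σᵥ (layer v₀ D)
        fv₀<layer = ≤-trans (subst (_< k ^ r) 1+r≡fv₀ (2+r≤k^r k≥3 r r≥1))
                            (Σᵥ-layer≥ v₀ r D (+-comm r d) D≤h)

    -- v₀ reaches beyond the leaves below it: clear the whole subtree of the ancestor a at distance t,
    -- all of which v₀ hears, and lay 1's on its k ^ (m + t) leaves.
    module DeepCase {t : ℕ} (a : Vertex k h) (v₀∈ : InSubtree a v₀ t)
                    (m<fv₀ : m < f v₀) (2t≤fv₀-m : t + t ≤ f v₀ ∸ m) where

      m+2t≤fv₀ : m + (t + t) ≤ f v₀
      m+2t≤fv₀ = ≤-trans (+-monoʳ-≤ m 2t≤fv₀-m) (≤-reflexive (m+[n∸m]≡n (<⇒≤ m<fv₀)))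

      h≡m+t+da : h ≡ (m + t) + depth a
      h≡m+t+da = trans (sym m+d≡h) (trans (cong (m +_) (InSubtree-depth {a = a} {x = v₀} v₀∈)) (sym (+-assoc m t _)))

      only-v₀ : ∀ y → ∃ (InSubtree a y) → depth y ≤ suc h → 0 < f y → y ≡ v₀
      only-v₀ y (e , y∈) _ fy>0 =
        proj₂ f-ib y v₀ fy>0 fv₀>0 (e + t , e+t≤fv₀ , ascentWalk a y y∈ ++ʷ descentWalk a v₀ v₀∈)
        where
          e≤m+t : e ≤ m + t
          e≤m+t = +-cancelʳ-≤ (depth a) e (m + t)
                    (subst₂ _≤_ (InSubtree-depth {a = a} {x = y} y∈) h≡m+t+da (depth≤height y))
          e+t≤fv₀ : e + t ≤ f v₀
          e+t≤fv₀ = ≤-trans (+-monoˡ-≤ t e≤m+t) (≤-trans (≤-reflexive (+-assoc m t t)) m+2t≤fv₀)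

      module S = Surgery f f-ib a v₀ h h≥1 v₀∈ (depth≤height v₀) fv₀>0 only-v₀
                         (λ y _ h<y → ⊥-elim (<⇒≱ (<-trans (n<1+n h) h<y) (depth≤height y)))

      layer≥ : k ^ (m + t) ≤ Σᵥ (layer a h)
      layer≥ = Σᵥ-layer≥ a (m + t) h (sym h≡m+t+da) ≤-refl

      improve-deep-strict : f v₀ < k ^ (m + t) → Improvable f
      improve-deep-strict fv₀< = S.g , S.g-isIndepBroadcast , S.surgery-improves (≤-trans fv₀< layer≥)

      -- For m = 0, t = 1 and f v₀ = 3 the surgery only breaks even, but it removes the big value at v₀;
      -- once no big value is left, the grandparent of v₀ has become silent with silent neighbours.
      module Tie (m≡0 : m ≡ 0) (t≡1 : t ≡ 1) (fv₀≡3 : f v₀ ≡ 3) where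

        surgery-breaksEven : Σᵥ f ≤ Σᵥ S.g
        surgery-breaksEven = S.surgery-keeps (begin
          f v₀                ≡⟨ fv₀≡3 ⟩
          3                   ≤⟨ k^1>2 k≥3 ⟩
          k ^ 1               ≡⟨ cong (k ^_) (cong₂ _+_ m≡0 t≡1) ⟨
          k ^ (m + t)         ≤⟨ layer≥ ⟩
          Σᵥ (layer a h)      ∎)
          where open ≤-Reasoning

        h≡d : h ≡ d
        h≡d = trans (sym m+d≡h) (cong (_+ d) m≡0)

        d≥2 : 2 ≤ d
        d≥2 with 2 ≤? d
        ... | yes 2≤d = 2≤d
        ... | no 2≰d = ⊥-elim (1+n≰n (begin
          3          ≡⟨ fv₀≡3 ⟨
          f v₀       ≤⟨ broadcast≤ecc f (proj₁ f-ib) v₀ ⟩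
          h + d      ≡⟨ cong (_+ d) h≡d ⟩
          d + d      ≤⟨ +-mono-≤ d≤1 d≤1 ⟩
          2          ∎))
          where
            open ≤-Reasoning
            d≤1 : d ≤ 1
            d≤1 = ≤-pred (≰⇒> 2≰d)

        b : Vertex k h
        b = proj₁ (ancestor v₀ 2 d≥2)

        v₀∈b : InSubtree b v₀ 2
        v₀∈b = proj₂ (ancestor v₀ 2 d≥2)

        d≡2+db : d ≡ 2 + depth b
        d≡2+db = InSubtree-depth {a = b} {x = v₀} v₀∈b

        da≡1+db : depth a ≡ suc (depth b)
        da≡1+db = suc-injective (begin
          suc (depth a)    ≡⟨ cong (_+ depth a) t≡1 ⟨
          t + depth a      ≡⟨ InSubtree-depth {a = a} {x = v₀} v₀∈ ⟨
          d                ≡⟨ d≡2+db ⟩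
          2 + depth b      ∎)
          where open ≡-Reasoning

        nearB-hearsV₀ : ∀ {y n} → 0 < f y → n ≤ 3 → Walk y v₀ n → depth y ≡ d
        nearB-hearsV₀ {y} fy>0 n≤3 W =
          cong depth (proj₂ f-ib y v₀ fy>0 fv₀>0 (_ , ≤-trans n≤3 (≤-reflexive (sym fv₀≡3)) , W))

        b∉region : ¬ InRegion a h b
        b∉region ((e , b∈) , _) = 1+n≰n (begin
          suc (depth b)  ≡⟨ da≡1+db ⟨
          depth a        ≤⟨ m≤n+m _ e ⟩
          e + depth a    ≡⟨ InSubtree-depth {a = a} {x = b} b∈ ⟨
          depth b        ∎)
          where open ≤-Reasoning

        gb≡0 : S.g b ≡ 0
        gb≡0 with f b ℕ.≟ 0
        ... | yes fb≡0 = trans (surgery-out f a h b b∉region) fb≡0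
        ... | no fb≢0 = ⊥-elim (m+1+n≢n 1 (trans (sym d≡2+db) (sym db≡d)))
          where
            db≡d : depth b ≡ d
            db≡d = nearB-hearsV₀ (n≢0⇒n>0 fb≢0) (s≤s (s≤s z≤n)) (descentWalk b v₀ v₀∈b)

        silentNbrs : ∀ y → Adj y b → S.g y ≡ 0
        silentNbrs y adj with S.g y ℕ.≟ 0
        ... | yes gy≡0 = gy≡0
        ... | no gy≢0 = ⊥-elim (byRegion (inRegion? a h y))
          where
            gy>0 : 0 < S.g y
            gy>0 = n≢0⇒n>0 gy≢0
            notAtDepth-d : depth y ≢ d
            notAtDepth-d y≡d = 1+n≰n (subst (_≤ suc (depth b)) (trans y≡d d≡2+db) (Adj-depth≤ adj))
            byRegion : Dec (InRegion a h y) → ⊥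
            byRegion (yes y∈) = notAtDepth-d (trans (S.g>0-in⇒depth≡ y y∈ gy>0) h≡d)
            byRegion (no y∉) = notAtDepth-d
              (nearB-hearsV₀ (subst (0 <_) (surgery-out f a h y y∉) gy>0) ≤-refl (cons adj (descentWalk b v₀ v₀∈b)))

        improve-deep-tie : (∀ g → Σᵥ (big g) < Σᵥ (big f) → ImprovableIfBig g) → Improvable f
        improve-deep-tie IH with ∃ᵥ? (λ x → 2 ≤? S.g x)
        ... | yes (x , gx≥2) with IH S.g (S.surgery-fewerBig fv₀≥2) S.g-isIndepBroadcast x gx≥2
        ...   | g′ , g′-ib , g<g′ = g′ , g′-ib , ≤-<-trans surgery-breaksEven g<g′
        improve-deep-tie IH | no ∄big = A.g′ , A.g′-isIndepBroadcast , ≤-<-trans surgery-breaksEven A.g′-heavier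
          where
            g≤1 : ∀ x → S.g x ≤ 1
            g≤1 x = ≤-pred (≰⇒> (λ gx≥2 → ∄big (x , gx≥2)))
            d≢db : d ≢ depth b
            d≢db d≡db = m+1+n≢n 1 (trans (sym d≡2+db) d≡db)
            module A = Activate S.g S.g-isIndepBroadcast g≤1 b gb≡0 silentNbrs v₀ d≢db

    fv₀≤1+m+2t : m < f v₀ → ∀ t → (t ≡ d ⊎ f v₀ ∸ m < suc (suc (t + t))) → f v₀ ≤ suc (m + (t + t))
    fv₀≤1+m+2t _ t (inj₁ refl) = begin
      f v₀          ≤⟨ broadcast≤ecc f (proj₁ f-ib) v₀ ⟩
      h + t         ≡⟨ cong (_+ t) m+d≡h ⟨
      m + t + t     ≡⟨ +-assoc m t t ⟩
      m + (t + t)   ≤⟨ n≤1+n _ ⟩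
      suc (m + (t + t)) ∎
      where open ≤-Reasoning
    fv₀≤1+m+2t m<fv₀ t (inj₂ fv₀-m<) = begin
      f v₀                ≡⟨ m+[n∸m]≡n (<⇒≤ m<fv₀) ⟨
      m + (f v₀ ∸ m)      ≤⟨ +-monoʳ-≤ m (≤-pred fv₀-m<) ⟩
      m + suc (t + t)     ≡⟨ +-suc m _ ⟩
      suc (m + (t + t))   ∎
      where open ≤-Reasoning

    improve-deep : (∀ g → Σᵥ (big g) < Σᵥ (big f) → ImprovableIfBig g) → m < f v₀ → Improvable f
    improve-deep IH m<fv₀ with largestHalf d (f v₀ ∸ m)
    ... | t , t≤d , 2t≤fv₀-m , t≡d⊎ with ancestor v₀ t t≤d
    ...   | a , v₀∈ with <k^[m+t]-or-exception k≥3 (f v₀) m t fv₀≥2 (fv₀≤1+m+2t m<fv₀ t t≡d⊎)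
    ...     | inj₁ fv₀< = DeepCase.improve-deep-strict a v₀∈ m<fv₀ 2t≤fv₀-m fv₀<
    ...     | inj₂ (m≡0 , t≡1 , fv₀≡3) =
      DeepCase.Tie.improve-deep-tie a v₀∈ m<fv₀ 2t≤fv₀-m m≡0 t≡1 fv₀≡3 IH

  improve : ∀ fuel f → Σᵥ (big f) ≤ fuel → ImprovableIfBig f
  improve zero f #big≤0 f-ib v fv≥2 = ⊥-elim (1+n≰n (≤-trans (Σᵥ-big≥1 f v fv≥2) #big≤0))
  improve (suc fuel) f #big≤ f-ib v fv≥2 with deepestBig f h v fv≥2 (m∸n≤m h (depth v))
  ... | v₀ , fv₀≥2 , deeper≤1 with f v₀ ≤? h ∸ depth v₀
  ...   | yes shallow = improve-shallow f f-ib v₀ fv₀≥2 deeper≤1 shallow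
  ...   | no deep = improve-deep f f-ib v₀ fv₀≥2 IH (≰⇒> deep)
    where
      IH : ∀ g → Σᵥ (big g) < Σᵥ (big f) → ImprovableIfBig g
      IH g #big-g< = improve fuel g (≤-pred (≤-trans #big-g< #big≤))

  module _ (f : Vertex k h → ℕ) (f-ib : IsIndepBroadcast f) (f≤1 : ∀ v → f v ≤ 1)
           (l : Vertex k h) (l-leaf : IsLeaf l) (fl≡0 : f l ≡ 0) {p : Vertex k h} (l∈p : InSubtree p l 1) where

    private
      h≡1+dp : h ≡ 1 + depth p
      h≡1+dp = trans (sym l-leaf) (InSubtree-depth {a = p} {x = l} l∈p)

    silentParent⇒improvable : f p ≡ 0 → Improvable f
    silentParent⇒improvable fp≡0 = A.g′ , A.g′-isIndepBroadcast , A.g′-heavier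
      where
        root≢l : depth (root {k} {h}) ≢ depth l
        root≢l 0≡dl = <-irrefl (trans 0≡dl l-leaf) h≥1
        module A = Activate f f-ib f≤1 l fl≡0 (λ y adj → trans (cong f (leafNeighbour⇒parent l-leaf l∈p adj)) fp≡0)
                            root root≢l

    -- The parent p of l broadcasts at power 1; replacing it by its k ≥ 3 leaf children gains weight.
    loudParent⇒improvable : 0 < f p → Improvable f
    loudParent⇒improvable fp>0 = S.g , S.g-isIndepBroadcast , S.surgery-improves fp<layer
      where
        only-p : ∀ y → ∃ (InSubtree p y) → depth y ≤ suc h → 0 < f y → y ≡ p
        only-p y (e , y∈) _ fy>0 = proj₂ f-ib y p fy>0 fp>0 (e , ≤-trans e≤1 fp>0 , ascentWalk p y y∈)
          where
            e≤1 : e ≤ 1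
            e≤1 = +-cancelʳ-≤ (depth p) e 1
                    (subst₂ _≤_ (InSubtree-depth {a = p} {x = y} y∈) h≡1+dp (depth≤height y))
        module S = Surgery f f-ib p p h h≥1 here (depth≤height p) fp>0 only-p
                           (λ y _ h<y → ⊥-elim (<⇒≱ (<-trans (n<1+n h) h<y) (depth≤height y)))
        fp<layer : f p < Σᵥ (layer p h)
        fp<layer = ≤-trans (s≤s (f≤1 p)) (≤-trans (<⇒≤ (k^1>2 k≥3)) (Σᵥ-layer≥ p 1 h (sym h≡1+dp) ≤-refl))

  silentLeaf⇒improvable : ∀ f → IsIndepBroadcast f → (∀ v → f v ≤ 1) →
                          ∀ l → IsLeaf l → f l ≡ 0 → Improvable f
  silentLeaf⇒improvable f f-ib f≤1 l l-leaf fl≡0 with ancestor l 1 (≤-trans h≥1 (≤-reflexive (sym l-leaf)))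
  ... | p , l∈p with f p ℕ.≟ 0
  ...   | yes fp≡0 = silentParent⇒improvable f f-ib f≤1 l l-leaf fl≡0 l∈p fp≡0
  ...   | no fp≢0 = loudParent⇒improvable f f-ib f≤1 l l-leaf fl≡0 l∈p (n≢0⇒n>0 fp≢0)

mainTheorem16 : (k h : ℕ) → k ≥ 3 → h ≥ 1 → (f : Vertex k h → ℕ) → IsMaxIndepBroadcast f →
    ((v : Vertex k h) → f v ≤ 1) × ((l : Vertex k h) → IsLeaf l → f l ≡ 1)
mainTheorem16 k h k≥3 h≥1 f (f-ib , f-max) = f≤1 , leaf≡1
  where
    notImprovable : ¬ Improvable f
    notImprovable (g , g-ib , f<g) = <⇒≱ f<g (f-max g g-ib)

    f≤1 : (v : Vertex k h) → f v ≤ 1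
    f≤1 v = ≤-pred (≰⇒> (λ fv≥2 → notImprovable (improve k≥3 h≥1 (Σᵥ (big f)) f ≤-refl f-ib v fv≥2)))

    leaf≡1 : (l : Vertex k h) → IsLeaf l → f l ≡ 1
    leaf≡1 l l-leaf =
      ≤-antisym (f≤1 l) (n≢0⇒n>0 (notImprovable ∘ silentLeaf⇒improvable k≥3 h≥1 f f-ib f≤1 l l-leaf))
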